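{- Let $n\ge k\ge 1$ and let $K_k$ be the $k\times 2^k$ $0$-$1$ matrix whose columns are all distinct $0$-$1$ columns of length $k$. Every row of every monotonically $K_k$-saturated $n$-row matrix contains at least $2^{k-1}-1$ ones and at least $2^{k-1}-1$ zeros.
   Context: A matrix is simple if it has no repeated columns. A matrix $F$ is a submatrix of $A$ if, after deleting some rows and columns of $A$, one obtains a row and column permutation of $F$. For an $n$-row matrix $M$ and $A\subseteq[n]$, $M(A,)$ is the submatrix formed by the rows in $A$, and $[M,C]$ is $M$ with column $C$ appended. A simple $n$-row $0$-$1$ matrix $M$ is monotonically $K_k$-saturated if for every $0$-$1$ $n$-column $C$ not a column of $M$ there is $A\subseteq[n]$ such that $M(A,)$ does not contain $K_k$ as a submatrix while $[M,C](A,)$ does. -}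

module Defs where

open import Data.Bool using (Bool; true; false; if_then_else_)
open import Data.Nat using (ℕ; zero; suc; _^_)
open import Data.Fin using (Fin; zero; suc; fromℕ; inject₁)
open import Data.Fin.Subset using (Subset; _∈_)
open import Data.Vec using (Vec; []; _∷_; _++_; map; lookup; tabulate; sum)
open import Data.Product using (Σ; ∃; ∃₂; _×_; _,_; proj₁)
open import Relation.Binary.PropositionalEquality using (_≡_)
open import Relation.Nullary using (¬_)
open import Function.Definitions using (Injective)

-- A 0-1 matrix with n rows and m columns, given as its list of columns
-- (column j is a Vec Bool n).
Matrix : ℕ → ℕ → Set
Matrix n m = Fin m → Vec Bool n

Entries : Set → Set → Set
Entries R C = R → C → Bool

entries : ∀ {n m} → Matrix n m → Entries (Fin n) (Fin m)
entries M i j = lookup (M j) i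

Simple : ∀ {n m} → Matrix n m → Set
Simple M = Injective _≡_ _≡_ M

-- F (p × q) is a submatrix of E: after deleting rows/columns of E one gets
-- a row and column permutation of F, i.e. injective row and column maps.
SubmatrixOf : ∀ {p q} {R C : Set} → Entries (Fin p) (Fin q) → Entries R C → Set
SubmatrixOf {p} {q} {R} {C} F E =
  Σ (Fin p → R) λ f → Σ (Fin q → C) λ g →
    Injective _≡_ _≡_ f × Injective _≡_ _≡_ g × (∀ i j → E (f i) (g j) ≡ F i j)

-- M(A,) : the submatrix formed by the rows of M lying in A ⊆ [n]
restrictRows : ∀ {n} {C : Set} (A : Subset n) → Entries (Fin n) C →
               Entries (Σ (Fin n) (λ i → i ∈ A)) C
restrictRows A E r c = E (proj₁ r) c

-- [M, C] : M with the column C appended (as last column)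
appendCol : ∀ {n m} → Matrix n m → Vec Bool n → Matrix n (suc m)
appendCol {m = zero}  M C zero    = C
appendCol {m = suc m} M C zero    = M zero
appendCol {m = suc m} M C (suc j) = appendCol (λ j' → M (suc j')) C j

-- all 0-1 columns of length k, each exactly once (2 ^ suc k ≡ 2^k + (2^k + 0) definitionally)
allCols : (k : ℕ) → Vec (Vec Bool k) (2 ^ k)
allCols zero    = [] ∷ []
allCols (suc k) = map (false ∷_) (allCols k) ++ (map (true ∷_) (allCols k) ++ [])

K : (k : ℕ) → Matrix k (2 ^ k)
K k j = lookup (allCols k) j

MonotonicallySaturated : (k : ℕ) → ∀ {n m} → Matrix n m → Set
MonotonicallySaturated k {n} M =
  Simple M ×
  (∀ (C : Vec Bool n) → (∀ j → ¬ (M j ≡ C)) →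
     Σ (Subset n) λ A →
       ¬ SubmatrixOf (entries (K k)) (restrictRows A (entries M)) ×
       SubmatrixOf (entries (K k)) (restrictRows A (entries (appendCol M C))))

onesInRow : ∀ {n m} → Matrix n m → Fin n → ℕ
onesInRow M i = sum (tabulate λ j → if lookup (M j) i then 1 else 0)

zerosInRow : ∀ {n m} → Matrix n m → Fin n → ℕ
zerosInRow M i = sum (tabulate λ j → if lookup (M j) i then 0 else 1)

module Submission where

-- Fix a row i of a monotonically K_k-saturated M (k = k' + 1) and a bit b; we
-- exhibit 2^k' ∸ 1 distinct columns of M with b in row i (module RowBound).
--  (a) The flip C of some column M j in row i is missing.  Saturation puts K_k
--      in [M,C](A,); a copy avoiding row i would survive replacing C by M j,
--      putting K_k in M(A,).  So the copy uses row i, and its 2^k' columns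
--      with b there are columns of [M,C], at most one of them C.
--  (b) M is closed under flipping row i but misses some C.  A copy through
--      row i is as in (a); a copy avoiding it gives 2^k ∸ 1 columns of M with
--      distinct restrictions to its rows, and flipping row i where needed
--      keeps them distinct while making that entry b.
--  (c) M has every column; half of all 2^n columns have b in row i.

open import Defs
open import Data.Nat using (ℕ; _≤_; _^_; _∸_; zero; suc; _+_; z≤n; s≤s)
open import Data.Nat.Properties using (≤-trans; ≤-refl; +-mono-≤; m≤n+m; m≤m+n; m∸n≤m; ∸-monoˡ-≤; ^-monoʳ-≤)
open import Data.Bool using (Bool; true; false; not; if_then_else_)
open import Data.Bool.Properties using (¬-not)
import Data.Bool as Bool
open import Data.Fin using (Fin; zero; suc; fromℕ; inject₁; _↑ˡ_; _↑ʳ_; splitAt; punchIn; punchOut; _≟_)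
open import Data.Fin.Properties using (splitAt⁻¹-↑ˡ; splitAt⁻¹-↑ʳ; inject₁-injective; punchIn-injective; punchInᵢ≢i; punchOut-injective; punchIn-punchOut; suc-injective; any?; all?; ¬∀⟶∃¬; injective⇒≤)
open import Data.Fin.Subset using (Subset; _∈_)
open import Data.Vec using (Vec; []; _∷_; _++_; map; lookup; tabulate; sum; insertAt; removeAt; updateAt)
open import Data.Vec.Properties using (lookup-++ˡ; lookup-++ʳ; lookup-map; insertAt-lookup; removeAt-insertAt; lookup∘updateAt; lookup∘updateAt′; ≡-dec)
open import Data.Vec.Relation.Binary.Pointwise.Extensional using (ext; Pointwise-≡⇒≡)
open import Data.Product using (_×_; Σ; ∃; _,_; proj₁; proj₂)
open import Data.Sum using (_⊎_; inj₁; inj₂)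
open import Data.Empty using (⊥-elim)
open import Function using (_∘_)
open import Relation.Nullary using (¬_; Dec; yes; no)
open import Relation.Binary.PropositionalEquality using (_≡_; _≢_; refl; sym; trans; cong; subst; module ≡-Reasoning)
open import Function.Definitions using (Injective)

open ≡-Reasoning

punchIn-fromℕ : ∀ {m} (j : Fin m) → punchIn (fromℕ m) j ≡ inject₁ j
punchIn-fromℕ zero    = refl
punchIn-fromℕ (suc j) = cong suc (punchIn-fromℕ j)

avoidPoint : ∀ {N m} (φ : Fin N → Fin (suc m)) → Injective _≡_ _≡_ φ →
             (t : Fin (suc m)) → (∀ x → t ≢ φ x) →
             Σ (Fin N → Fin m) λ ψ → Injective _≡_ _≡_ ψ × (∀ x → punchIn t (ψ x) ≡ φ x)
avoidPoint φ φ-inj t miss =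
  (λ x → punchOut (miss x)) ,
  (λ eq → φ-inj (punchOut-injective (miss _) (miss _) eq)) ,
  (λ x → punchIn-punchOut (miss x))

deletePoint : ∀ {p m} (φ : Fin (suc p) → Fin (suc m)) → Injective _≡_ _≡_ φ →
              {t : Fin (suc m)} (x₀ : Fin (suc p)) → φ x₀ ≡ t →
              Σ (Fin p → Fin m) λ ψ → Injective _≡_ _≡_ ψ × (∀ x → punchIn t (ψ x) ≡ φ (punchIn x₀ x))
deletePoint φ φ-inj {t} x₀ hit =
  avoidPoint (φ ∘ punchIn x₀) (λ eq → punchIn-injective x₀ _ _ (φ-inj eq)) t
             (λ x eq → punchInᵢ≢i x₀ x (sym (φ-inj (trans hit eq))))

dropPoint : ∀ {N m} (φ : Fin N → Fin (suc m)) → Injective _≡_ _≡_ φ → (t : Fin (suc m)) →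
            Σ (Fin (N ∸ 1) → Fin m) λ ψ → Injective _≡_ _≡_ ψ × (∀ x → ∃ λ y → φ y ≡ punchIn t (ψ x))
dropPoint {zero} φ φ-inj t = (λ ()) , (λ { {()} }) , (λ ())
dropPoint {suc p} φ φ-inj t with any? (λ x → φ x ≟ t)
... | yes (x₀ , hit) =
  let (ψ , ψ-inj , ψ-spec) = deletePoint φ φ-inj x₀ hit
  in ψ , ψ-inj , λ x → punchIn x₀ x , sym (ψ-spec x)
... | no miss =
  let (ψ , ψ-inj , ψ-spec) = avoidPoint φ φ-inj t (λ x eq → miss (x , sym eq))
  in ψ ∘ suc , suc-injective ∘ ψ-inj , λ x → suc x , sym (ψ-spec (suc x))

sum-≥-injection : ∀ m {q} (c : Fin m → ℕ) (ψ : Fin q → Fin m) → Injective _≡_ _≡_ ψ →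
                  (∀ x → 1 ≤ c (ψ x)) → q ≤ sum (tabulate c)
sum-≥-injection zero c ψ ψ-inj pos = injective⇒≤ ψ-inj
sum-≥-injection (suc m) {q} c ψ ψ-inj pos with any? (λ x → ψ x ≟ zero)
sum-≥-injection (suc m) {suc p} c ψ ψ-inj pos | yes (x₀ , hit) =
  +-mono-≤ (subst (λ z → 1 ≤ c z) hit (pos x₀)) (sum-≥-injection m (c ∘ suc) ψ′ ψ′-inj pos′)
  where
  deleted : Σ (Fin p → Fin m) λ ψ′ → Injective _≡_ _≡_ ψ′ × (∀ x → suc (ψ′ x) ≡ ψ (punchIn x₀ x))
  deleted = deletePoint ψ ψ-inj x₀ hit
  ψ′ : Fin p → Fin m
  ψ′ = proj₁ deleted
  ψ′-inj : Injective _≡_ _≡_ ψ′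
  ψ′-inj = proj₁ (proj₂ deleted)
  pos′ : ∀ x → 1 ≤ c (suc (ψ′ x))
  pos′ x = subst (λ z → 1 ≤ c z) (sym (proj₂ (proj₂ deleted) x)) (pos (punchIn x₀ x))
... | no miss = ≤-trans (sum-≥-injection m (c ∘ suc) ψ′ ψ′-inj pos′) (m≤n+m _ (c zero))
  where
  avoided : Σ (Fin q → Fin m) λ ψ′ → Injective _≡_ _≡_ ψ′ × (∀ x → suc (ψ′ x) ≡ ψ x)
  avoided = avoidPoint ψ ψ-inj zero (λ x eq → miss (x , sym eq))
  ψ′ : Fin q → Fin m
  ψ′ = proj₁ avoided
  ψ′-inj : Injective _≡_ _≡_ ψ′
  ψ′-inj = proj₁ (proj₂ avoided)
  pos′ : ∀ x → 1 ≤ c (suc (ψ′ x))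
  pos′ x = subst (λ z → 1 ≤ c z) (sym (proj₂ (proj₂ avoided) x)) (pos x)

insertAt-injective : ∀ {A : Set} {k} (r : Fin (suc k)) (a : A) {u v : Vec A k} →
                     insertAt u r a ≡ insertAt v r a → u ≡ v
insertAt-injective r a {u} {v} eq = begin
  u                           ≡⟨ sym (removeAt-insertAt u r a) ⟩
  removeAt (insertAt u r a) r ≡⟨ cong (λ w → removeAt w r) eq ⟩
  removeAt (insertAt v r a) r ≡⟨ removeAt-insertAt v r a ⟩
  v                           ∎

data HalfView (N : ℕ) : Fin (N + (N + 0)) → Set where
  firstHalf  : (a : Fin N) → HalfView N (a ↑ˡ (N + 0))
  secondHalf : (a : Fin N) → HalfView N (N ↑ʳ (a ↑ˡ 0))

halfView : ∀ N (c : Fin (N + (N + 0))) → HalfView N c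
halfView N c with splitAt N c in eq
... | inj₁ a = subst (HalfView N) (splitAt⁻¹-↑ˡ eq) (firstHalf a)
... | inj₂ d with splitAt N {0} d in eq′
...   | inj₁ a = subst (HalfView N) (trans (cong (N ↑ʳ_) (splitAt⁻¹-↑ˡ eq′)) (splitAt⁻¹-↑ʳ eq)) (secondHalf a)
...   | inj₂ ()

K-firstHalf : ∀ k (a : Fin (2 ^ k)) → K (suc k) (a ↑ˡ (2 ^ k + 0)) ≡ false ∷ K k a
K-firstHalf k a = trans (lookup-++ˡ (map (false ∷_) (allCols k)) _ a) (lookup-map a (false ∷_) (allCols k))

K-secondHalf : ∀ k (a : Fin (2 ^ k)) → K (suc k) (2 ^ k ↑ʳ (a ↑ˡ 0)) ≡ true ∷ K k a
K-secondHalf k a =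
  trans (lookup-++ʳ (map (false ∷_) (allCols k)) _ (a ↑ˡ 0))
        (trans (lookup-++ˡ (map (true ∷_) (allCols k)) [] a) (lookup-map a (true ∷_) (allCols k)))

code : ∀ k → Vec Bool k → Fin (2 ^ k)
code zero    []          = zero
code (suc k) (false ∷ w) = code k w ↑ˡ _
code (suc k) (true ∷ w)  = 2 ^ k ↑ʳ (code k w ↑ˡ 0)

K-complete : ∀ k (v : Vec Bool k) → K k (code k v) ≡ v
K-complete zero    []          = refl
K-complete (suc k) (false ∷ w) = trans (K-firstHalf k (code k w)) (cong (false ∷_) (K-complete k w))
K-complete (suc k) (true ∷ w)  = trans (K-secondHalf k (code k w)) (cong (true ∷_) (K-complete k w))

code-K : ∀ k (c : Fin (2 ^ k)) → code k (K k c) ≡ c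
code-K zero    zero = refl
code-K (suc k) c with halfView (2 ^ k) c
... | firstHalf a  rewrite K-firstHalf k a  = cong (_↑ˡ _) (code-K k a)
... | secondHalf a rewrite K-secondHalf k a = cong (λ z → 2 ^ k ↑ʳ (z ↑ˡ 0)) (code-K k a)

K-simple : ∀ k → Injective _≡_ _≡_ (K k)
K-simple k {c} {c′} eq = trans (sym (code-K k c)) (trans (cong (code k) eq) (code-K k c′))

ColumnsWith : ∀ {n m} → Matrix n m → Fin n → Bool → ℕ → Set
ColumnsWith {m = m} M i b q =
  Σ (Fin q → Fin m) λ ψ → Injective _≡_ _≡_ ψ × (∀ x → lookup (M (ψ x)) i ≡ b)

onesInRow-≥ : ∀ {n m q} (M : Matrix n m) (i : Fin n) → ColumnsWith M i true q → q ≤ onesInRow M i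
onesInRow-≥ {m = m} M i (ψ , ψ-inj , val) =
  sum-≥-injection m _ ψ ψ-inj λ x → subst (λ z → 1 ≤ (if z then 1 else 0)) (sym (val x)) ≤-refl

zerosInRow-≥ : ∀ {n m q} (M : Matrix n m) (i : Fin n) → ColumnsWith M i false q → q ≤ zerosInRow M i
zerosInRow-≥ {m = m} M i (ψ , ψ-inj , val) =
  sum-≥-injection m _ ψ ψ-inj λ x → subst (λ z → 1 ≤ (if z then 0 else 1)) (sym (val x)) ≤-refl

K-columnsWith : ∀ k (r : Fin (suc k)) b → ColumnsWith (K (suc k)) r b (2 ^ k)
K-columnsWith k r b = ψ , ψ-inj , val
  where
  ψ : Fin (2 ^ k) → Fin (2 ^ suc k)
  ψ x = code (suc k) (insertAt (K k x) r b)
  column : ∀ x → K (suc k) (ψ x) ≡ insertAt (K k x) r b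
  column x = K-complete (suc k) (insertAt (K k x) r b)
  ψ-inj : Injective _≡_ _≡_ ψ
  ψ-inj {x} {y} eq =
    K-simple k (insertAt-injective r b (trans (sym (column x)) (trans (cong (K (suc k)) eq) (column y))))
  val : ∀ x → lookup (K (suc k) (ψ x)) r ≡ b
  val x = trans (cong (λ v → lookup v r) (column x)) (insertAt-lookup (K k x) r b)

transportColumns : ∀ {n m p q N} {E : Matrix n m} {F : Matrix p q} {i : Fin n} {r : Fin p} {b : Bool}
                   (g : Fin q → Fin m) → Injective _≡_ _≡_ g →
                   (∀ c → lookup (E (g c)) i ≡ lookup (F c) r) →
                   ColumnsWith F r b N → ColumnsWith E i b N
transportColumns g g-inj copies (ψ , ψ-inj , val) =
  g ∘ ψ , ψ-inj ∘ g-inj , λ x → trans (copies (ψ x)) (val x)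

appendCol-inject₁ : ∀ {n m} (M : Matrix n m) C (j : Fin m) → appendCol M C (inject₁ j) ≡ M j
appendCol-inject₁ {m = suc m} M C zero    = refl
appendCol-inject₁ {m = suc m} M C (suc j) = appendCol-inject₁ (M ∘ suc) C j

appendCol-column : ∀ {n m} (M : Matrix n m) C (y : Fin (suc m)) →
                   appendCol M C y ≡ C ⊎ ∃ λ j → appendCol M C y ≡ M j
appendCol-column {m = zero}  M C zero    = inj₁ refl
appendCol-column {m = suc m} M C zero    = inj₂ (zero , refl)
appendCol-column {m = suc m} M C (suc y) with appendCol-column (M ∘ suc) C y
... | inj₁ eq       = inj₁ eq
... | inj₂ (j , eq) = inj₂ (suc j , eq)

dropAppended : ∀ {n m N} (M : Matrix n m) C (φ : Fin N → Fin (suc m)) → Injective _≡_ _≡_ φ →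
               Σ (Fin (N ∸ 1) → Fin m) λ ψ → Injective _≡_ _≡_ ψ ×
                 (∀ x → ∃ λ y → φ y ≡ inject₁ (ψ x) × appendCol M C (φ y) ≡ M (ψ x))
dropAppended {m = m} M C φ φ-inj =
  let (ψ , ψ-inj , hit) = dropPoint φ φ-inj (fromℕ m)
      inside x = trans (proj₂ (hit x)) (punchIn-fromℕ (ψ x))
  in ψ , ψ-inj , λ x → proj₁ (hit x) , inside x ,
                        trans (cong (appendCol M C) (inside x)) (appendCol-inject₁ M C (ψ x))

dropAppendedColumns : ∀ {n m N} {M : Matrix n m} {C i b} →
                      ColumnsWith (appendCol M C) i b N → ColumnsWith M i b (N ∸ 1)
dropAppendedColumns {M = M} {C} {i} (φ , φ-inj , val) =
  let (ψ , ψ-inj , hit) = dropAppended M C φ φ-inj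
  in ψ , ψ-inj , λ x → let (y , _ , same) = hit x in
       trans (cong (λ v → lookup v i) (sym same)) (val y)

-- The columns g of E, read on the rows ρ, spell out K_k.  (This is the
-- equation part of SubmatrixOf (entries (K k)) (restrictRows A (entries E)).)
Spells : ∀ {n m k} (ρ : Fin k → Fin n) (E : Matrix n m) (g : Fin (2 ^ k) → Fin m) → Set
Spells {k = k} ρ E g = ∀ r c → lookup (E (g c)) (ρ r) ≡ lookup (K k c) r

SeparatedBy : ∀ {n m p q} (ρ : Fin p → Fin n) (M : Matrix n m) (ψ : Fin q → Fin m) → Set
SeparatedBy ρ M ψ = ∀ {x x′} → (∀ r → lookup (M (ψ x)) (ρ r) ≡ lookup (M (ψ x′)) (ρ r)) → x ≡ x′

separated-injective : ∀ {n m p q} {ρ : Fin p → Fin n} {M : Matrix n m} {ψ : Fin q → Fin m} →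
                      SeparatedBy ρ M ψ → Injective _≡_ _≡_ ψ
separated-injective {ρ = ρ} {M} sep eq = sep λ r → cong (λ j → lookup (M j) (ρ r)) eq

spells-separated : ∀ {n m k} {ρ : Fin k → Fin n} {E : Matrix n m} {g} → Spells ρ E g → SeparatedBy ρ E g
spells-separated {k = k} spells {c} {c′} agree =
  K-simple k (Pointwise-≡⇒≡ (ext λ r → trans (sym (spells r c)) (trans (agree r) (spells r c′))))

dropAppendedSeparated : ∀ {n m p N} {ρ : Fin p → Fin n} (M : Matrix n m) C {φ : Fin N → Fin (suc m)} →
                        SeparatedBy ρ (appendCol M C) φ →
                        Σ (Fin (N ∸ 1) → Fin m) λ ψ → SeparatedBy ρ M ψ
dropAppendedSeparated {ρ = ρ} M C {φ} sep =
  let (ψ , ψ-inj , hit) = dropAppended M C φ (separated-injective {ρ = ρ} {appendCol M C} sep)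
      separate : SeparatedBy ρ M ψ
      separate {x} {x′} agree =
        let (y , inside , same) = hit x ; (y′ , inside′ , same′) = hit x′
            y≡y′ = sep λ r → trans (cong (λ v → lookup v (ρ r)) same)
                               (trans (agree r) (cong (λ v → lookup v (ρ r)) (sym same′)))
        in ψ-inj (inject₁-injective (trans (sym inside) (trans (cong φ y≡y′) inside′)))
  in ψ , separate

spellsWithoutAppended : ∀ {n m k} {ρ : Fin k → Fin n} (M : Matrix n m) C (j : Fin m) →
                        (∀ r → lookup C (ρ r) ≡ lookup (M j) (ρ r)) →
                        (g : Fin (2 ^ k) → Fin (suc m)) → Spells ρ (appendCol M C) g →
                        Σ (Fin (2 ^ k) → Fin m) λ g′ → Spells ρ M g′
spellsWithoutAppended {m = m} {k} {ρ} M C j C≈Mj g spells =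
  (λ c → proj₁ (representative (g c))) , λ r c → trans (proj₂ (representative (g c)) r) (spells r c)
  where
  representative : (y : Fin (suc m)) → Σ (Fin m) λ j′ →
                   ∀ r → lookup (M j′) (ρ r) ≡ lookup (appendCol M C y) (ρ r)
  representative y with appendCol-column M C y
  ... | inj₁ isC        = j , λ r → trans (sym (C≈Mj r)) (cong (λ v → lookup v (ρ r)) (sym isC))
  ... | inj₂ (j′ , isM) = j′ , λ r → cong (λ v → lookup v (ρ r)) (sym isM)

flipAt : ∀ {n} → Vec Bool n → Fin n → Vec Bool n
flipAt v i = updateAt v i not

adjustRow : ∀ {n m} (M : Matrix n m) (i : Fin n) (b : Bool) →
            (∀ j → ∃ λ j′ → M j′ ≡ flipAt (M j) i) → (j : Fin m) →
            Σ (Fin m) λ j′ → lookup (M j′) i ≡ b × (∀ t → t ≢ i → lookup (M j′) t ≡ lookup (M j) t)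
adjustRow M i b closed j with lookup (M j) i Bool.≟ b
... | yes hasB = j , hasB , λ t _ → refl
... | no lacksB =
  let (j′ , flipped) = closed j
      entry t = cong (λ v → lookup v t) flipped
  in j′ , trans (entry i) (trans (lookup∘updateAt i (M j)) (sym (¬-not (lacksB ∘ sym)))) ,
          λ t t≢i → trans (entry t) (lookup∘updateAt′ t i t≢i (M j))

adjustSeparated : ∀ {n m p q} (M : Matrix n m) (i : Fin n) (b : Bool) →
                  (∀ j → ∃ λ j′ → M j′ ≡ flipAt (M j) i) →
                  (ρ : Fin p → Fin n) → (∀ r → ρ r ≢ i) →
                  (ψ : Fin q → Fin m) → SeparatedBy ρ M ψ → ColumnsWith M i b q
adjustSeparated {m = m} {q = q} M i b closed ρ avoids ψ sep = μ , μ-inj , λ x → proj₁ (proj₂ (adjusted x))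
  where
  adjusted : (x : Fin q) → Σ (Fin m) λ j′ →
             lookup (M j′) i ≡ b × (∀ t → t ≢ i → lookup (M j′) t ≡ lookup (M (ψ x)) t)
  adjusted x = adjustRow M i b closed (ψ x)
  μ : Fin q → Fin m
  μ x = proj₁ (adjusted x)
  sameOff : ∀ x r → lookup (M (μ x)) (ρ r) ≡ lookup (M (ψ x)) (ρ r)
  sameOff x r = proj₂ (proj₂ (adjusted x)) (ρ r) (avoids r)
  μ-inj : Injective _≡_ _≡_ μ
  μ-inj {x} {x′} eq = sep λ r →
    trans (sym (sameOff x r)) (trans (cong (λ j → lookup (M j) (ρ r)) eq) (sameOff x′ r))

module RowBound {n′ m k′ : ℕ} (M : Matrix (suc n′) m) (sat : MonotonicallySaturated (suc k′) M)
                (k′≤n′ : k′ ≤ n′) (i : Fin (suc n′)) (b : Bool) where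

  k n : ℕ
  k = suc k′
  n = suc n′

  Many : Set
  Many = Σ ℕ λ q → (2 ^ k′ ∸ 1 ≤ q) × ColumnsWith M i b q

  throughRow : (C : Vec Bool n) (ρ : Fin k → Fin n) (g : Fin (2 ^ k) → Fin (suc m)) →
               Injective _≡_ _≡_ g → Spells ρ (appendCol M C) g → (r₀ : Fin k) → ρ r₀ ≡ i → Many
  throughRow C ρ g g-inj spells r₀ refl =
    2 ^ k′ ∸ 1 , ≤-refl ,
    dropAppendedColumns {M = M} {C}
      (transportColumns {E = appendCol M C} {F = K k} g g-inj (spells r₀) (K-columnsWith k′ r₀ b))

  fromMissing : (C : Vec Bool n) → (∀ j → ¬ (M j ≡ C)) →
    ((A : Subset n) → ¬ SubmatrixOf (entries (K k)) (restrictRows A (entries M)) →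
     (f : Fin k → Σ (Fin n) (_∈ A)) → Injective _≡_ _≡_ f →
     (g : Fin (2 ^ k) → Fin (suc m)) → Spells (proj₁ ∘ f) (appendCol M C) g →
     (∀ r → proj₁ (f r) ≢ i) → Many) → Many
  fromMissing C missing avoiding with proj₂ sat C missing
  ... | A , noCopy , (f , g , f-inj , g-inj , spells) with any? (λ r → proj₁ (f r) ≟ i)
  ...   | yes (r₀ , meets) = throughRow C (proj₁ ∘ f) g g-inj spells r₀ meets
  ...   | no misses        = avoiding A noCopy f f-inj g spells λ r eq → misses (r , eq)

  flipMissing : (j : Fin m) → (∀ j′ → ¬ (M j′ ≡ flipAt (M j) i)) → Many
  flipMissing j missing = fromMissing (flipAt (M j) i) missing
    λ A noCopy f f-inj g spells avoids →
      let (g′ , spells′) = spellsWithoutAppended M (flipAt (M j) i) j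
                             (λ r → lookup∘updateAt′ (proj₁ (f r)) i (avoids r) (M j)) g spells
      in ⊥-elim (noCopy (f , g′ , f-inj , separated-injective {ρ = proj₁ ∘ f} {M}
                                               (spells-separated {ρ = proj₁ ∘ f} {M} spells′) , spells′))

  flipClosed : (∀ j → ∃ λ j′ → M j′ ≡ flipAt (M j) i) → (C : Vec Bool n) → (∀ j → ¬ (M j ≡ C)) → Many
  flipClosed closed C missing = fromMissing C missing
    λ A noCopy f f-inj g spells avoids →
      let (ψ , sep) = dropAppendedSeparated M C (spells-separated {ρ = proj₁ ∘ f} {appendCol M C} spells)
      in 2 ^ k ∸ 1 , ∸-monoˡ-≤ 1 (m≤m+n (2 ^ k′) _) ,
         adjustSeparated M i b closed (proj₁ ∘ f) avoids ψ sep

  complete : (∀ c → ∃ λ j → M j ≡ K n c) → Many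
  complete present =
    2 ^ n′ , ≤-trans (m∸n≤m (2 ^ k′) 1) (^-monoʳ-≤ 2 k′≤n′) ,
    transportColumns {E = M} {F = K n} g g-inj (λ c → cong (λ v → lookup v i) (proj₂ (present c))) (K-columnsWith n′ i b)
    where
    g : Fin (2 ^ n) → Fin m
    g c = proj₁ (present c)
    g-inj : Injective _≡_ _≡_ g
    g-inj {c} {c′} eq = K-simple n (trans (sym (proj₂ (present c))) (trans (cong M eq) (proj₂ (present c′))))

  hasFlip? : (j : Fin m) → Dec (∃ λ j′ → M j′ ≡ flipAt (M j) i)
  hasFlip? j = any? (λ j′ → ≡-dec Bool._≟_ (M j′) (flipAt (M j) i))

  occurs? : (c : Fin (2 ^ n)) → Dec (∃ λ j → M j ≡ K n c)
  occurs? c = any? (λ j → ≡-dec Bool._≟_ (M j) (K n c))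

  many : Many
  many with all? hasFlip?
  ... | no notClosed =
    let (j , noFlip) = ¬∀⟶∃¬ m _ hasFlip? notClosed
    in flipMissing j (λ j′ eq → noFlip (j′ , eq))
  ... | yes closed with all? occurs?
  ...   | yes present = complete present
  ...   | no incomplete =
    let (c , absent) = ¬∀⟶∃¬ (2 ^ n) _ occurs? incomplete
    in flipClosed closed (K n c) (λ j eq → absent (j , eq))

mainTheorem3 : (n k : ℕ) → 1 ≤ k → k ≤ n → (m : ℕ) (M : Matrix n m) →
    MonotonicallySaturated k M → (i : Fin n) →
    (2 ^ (k ∸ 1) ∸ 1 ≤ onesInRow M i) × (2 ^ (k ∸ 1) ∸ 1 ≤ zerosInRow M i)
mainTheorem3 (suc n′) (suc k′) (s≤s z≤n) (s≤s k′≤n′) m M sat i =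
  let (_ , big₁ , ones)  = RowBound.many M sat k′≤n′ i true
      (_ , big₀ , zeros) = RowBound.many M sat k′≤n′ i false
  in ≤-trans big₁ (onesInRow-≥ M i ones) , ≤-trans big₀ (zerosInRow-≥ M i zeros)
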